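{- Let $k$ be an even integer greater than $2$ and $n$ an odd integer greater than $k$. Let $G=(\mathbb{Z}_n;\{1,2,\dots,k-1\})$ be the hypergraph with vertex set $\mathbb{Z}_n$ and edges $\{i,i+1,\dots,i+k-1\}$ (indices mod $n$) for $i\in\mathbb{Z}_n$. Then $G$ is minimal non-odd-bipartite if and only if $\gcd(k,n)=1$.
   Context: For $k$ even, a $k$-uniform hypergraph $G$ (every edge has $k$ vertices, no multiple edges) is odd-bipartite if there is a bipartition $\{U,U^c\}$ of $V(G)$ such that every edge meets $U$ (and hence $U^c$) in an odd number of vertices. It is minimal non-odd-bipartite if it is not odd-bipartite but $G-e$ (delete the edge $e$ from the edge set) is odd-bipartite for every edge $e$. -}

module Defs where

open import Data.Nat using (ℕ; suc; _+_; _<_; _%_; _∸_)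
open import Data.Fin using (Fin; toℕ)
open import Data.Fin.Subset using (Subset; _∩_; ∣_∣)
open import Data.Fin.Properties using (_≟_)
open import Data.Bool using (true; false)
open import Data.Vec using (tabulate)
open import Data.List using (List; map; filter; length)
open import Data.List.Membership.Propositional using (_∈_)
open import Data.List.Relation.Unary.All using (All)
open import Data.List.Relation.Unary.Unique.Propositional using (Unique)
open import Data.Product using (Σ; ∃; _×_)
open import Relation.Binary.PropositionalEquality using (_≡_)
open import Relation.Nullary using (¬_; does)
open import Relation.Nullary.Decidable using (¬?)
open import Data.Vec.Properties using (≡-dec)
import Data.Bool.Properties as BoolP

Odd : ℕ → Set
Odd m = m % 2 ≡ 1

record Hypergraph (n : ℕ) : Set where
  constructor hypergraph
  field
    edges : List (Subset n)

open Hypergraph public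

IsUniform : ∀ {n} → ℕ → Hypergraph n → Set
IsUniform k G = All (λ e → ∣ e ∣ ≡ k) (edges G) × Unique (edges G)

-- odd-bipartite: some U meets every edge in an odd number of vertices
-- (then U^c also meets every edge in an odd number, as k is even)
OddBipartite : ∀ {n} → Hypergraph n → Set
OddBipartite {n} G = Σ (Subset n) λ U → All (λ e → Odd ∣ e ∩ U ∣) (edges G)

deleteEdge : ∀ {n} → Hypergraph n → Subset n → Hypergraph n
deleteEdge G e = hypergraph (filter (λ f → ¬? (≡-dec BoolP._≟_ f e)) (edges G))

MinimalNonOddBipartite : ∀ {n} → Hypergraph n → Set
MinimalNonOddBipartite G =
  ¬ OddBipartite G × (∀ e → e ∈ edges G → OddBipartite (deleteEdge G e))

-- vertex j lies in the edge starting at i, i.e. (j - i) mod n < k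
-- (computed as (j + n - i) % n, which avoids truncated subtraction)
inWindow : ∀ {n} → ℕ → Fin n → Fin n → Data.Bool.Bool
inWindow {n} k i j = does (((toℕ j + n) ∸ toℕ i) Data.Nat.% suc (n ∸ 1) Data.Nat.<? k)
  where import Data.Nat

window : ∀ {n} → ℕ → Fin n → Subset n
window k i = tabulate (inWindow k i)

cyclicHypergraph : (n k : ℕ) → Hypergraph n
cyclicHypergraph n k = hypergraph (map (window k) (Data.List.allFin n))

Even : ℕ → Set
Even m = m % 2 ≡ 0

module Submission where

-- Read a vertex set U through its n-periodic indicator χ on ℕ, so that
-- |W_i ∩ U| is the sum of χ over i, …, i + k - 1. If k = κd and n = νd with
-- κ even and ν odd, the ν windows starting at r, r + d, …, r + (ν - 1)d cover
-- every vertex exactly κ times; their intersections with U add up to κ|U|,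
-- which is even, so they cannot all be odd. With d = 1 this says G is not
-- odd-bipartite; if d = gcd(k, n) > 1 (then d and ν are odd and κ is even) the
-- windows starting at 1, 1 + d, … all survive the deletion of W₀.
-- Conversely, if gcd(k, n) = 1 take qk = 1 + Ln; L is odd because k is even.
-- After deleting W_c let U be the set of vertices j such that j, j + k, …,
-- j + (q - 1)k meets c an odd number of times. Summed over W_i these counts
-- count how often i, i + 1, …, i + qk - 1 meets c: L times, plus once more if
-- i = c. So U meets exactly the windows W_i with i ≠ c oddly.

open import Data.Bool using (Bool; true; false; _∧_; T)
open import Data.Empty using (⊥-elim)
open import Data.Fin as Fin using (Fin; toℕ; fromℕ<; inject₁)
open import Data.Fin.Properties using (toℕ-injective; toℕ-fromℕ<; toℕ<n; toℕ-inject₁)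
open import Data.Fin.Subset using (Subset; _∩_; ∣_∣)
open import Data.List.Membership.Propositional using (_∈_)
open import Data.List.Membership.Propositional.Properties using (∈-map⁺; ∈-map⁻; ∈-filter⁺; ∈-filter⁻; ∈-allFin)
open import Data.List using (allFin)
import Data.List.Relation.Unary.All as All
open import Data.Nat using (ℕ; zero; suc; _+_; _*_; _∸_; _≤_; _<_; z≤n; s≤s; s≤s⁻¹; z<s; s<s; _%_; _<?_; _≟_; NonZero)
open import Data.Nat.DivMod
open import Data.Nat.Divisibility using (divides)
open import Data.Nat.GCD using (gcd; GCD; gcd-GCD; gcd[m,n]∣m; gcd[m,n]∣n; module Bézout)
open import Data.Nat.Properties
open import Data.Nat.Tactic.RingSolver using (solve-∀)
open import Data.Product using (∃₂; _×_; _,_; proj₁; proj₂)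
open import Data.Sum using (_⊎_; inj₁; inj₂)
open import Data.Vec using ([]; _∷_; lookup; tabulate)
open import Data.Vec.Properties using (lookup-zipWith; lookup∘tabulate; ≡-dec)
import Data.Bool.Properties as Bool
open import Function.Base using (_∘_)
open import Function.Bundles using (_⇔_; mk⇔)
open import Relation.Binary.PropositionalEquality
open import Relation.Nullary using (¬_; does; yes; no)
open import Relation.Nullary.Decidable using (dec-true; dec-false; ¬?)
open import Defs
open ≡-Reasoning

-- Sums over initial segments of ℕ

bit : Bool → ℕ
bit true  = 1
bit false = 0

bit-∧ : ∀ a b → bit (a ∧ b) ≡ bit a * bit b
bit-∧ true  b = sym (*-identityˡ (bit b))
bit-∧ false b = refl

does<?⇒< : ∀ {m n} → does (m <? n) ≡ true → m < n
does<?⇒< {m} {n} m<?n = <ᵇ⇒< m n (subst T (sym m<?n) _)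

∑ : ℕ → (ℕ → ℕ) → ℕ
∑ zero    f = 0
∑ (suc m) f = f 0 + ∑ m (λ v → f (suc v))

infix 5 ∑
syntax ∑ m (λ v → e) = ∑[ v < m ] e

∑-cong : ∀ m {f g : ℕ → ℕ} → (∀ v → v < m → f v ≡ g v) → ∑ m f ≡ ∑ m g
∑-cong zero    f≡g = refl
∑-cong (suc m) f≡g = cong₂ _+_ (f≡g 0 z<s) (∑-cong m (λ v v<m → f≡g (suc v) (s≤s v<m)))

∑-const : ∀ m c → ∑[ _ < m ] c ≡ m * c
∑-const zero    c = refl
∑-const (suc m) c = cong (c +_) (∑-const m c)

∑-zero : ∀ m {f : ℕ → ℕ} → (∀ v → v < m → f v ≡ 0) → ∑ m f ≡ 0
∑-zero m f≡0 = trans (∑-cong m f≡0) (trans (∑-const m 0) (*-zeroʳ m))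

∑-split : ∀ a b (f : ℕ → ℕ) → ∑ (a + b) f ≡ ∑ a f + (∑[ v < b ] f (a + v))
∑-split zero    b f = refl
∑-split (suc a) b f =
  trans (cong (f 0 +_) (∑-split a b (λ v → f (suc v)))) (sym (+-assoc (f 0) _ _))

∑-+ : ∀ m (f g : ℕ → ℕ) → ∑[ v < m ] (f v + g v) ≡ ∑ m f + ∑ m g
∑-+ zero    f g = refl
∑-+ (suc m) f g = trans (cong (f 0 + g 0 +_) (∑-+ m _ _)) (+-interchange (f 0) (g 0) _ _)
  where
  +-interchange : ∀ a b c d → a + b + (c + d) ≡ a + c + (b + d)
  +-interchange = solve-∀

∑-swap : ∀ a b (f : ℕ → ℕ → ℕ) → ∑[ i < a ] ∑[ j < b ] f i j ≡ ∑[ j < b ] ∑[ i < a ] f i j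
∑-swap zero    b f = sym (∑-zero b (λ _ _ → refl))
∑-swap (suc a) b f = trans (cong (∑ b (f 0) +_) (∑-swap a b (λ i → f (suc i))))
                           (sym (∑-+ b (f 0) (λ j → ∑[ i < a ] f (suc i) j)))

∑-block : ∀ q k (f : ℕ → ℕ) → ∑ (q * k) f ≡ ∑[ m < q ] ∑[ t < k ] f (m * k + t)
∑-block zero    k f = refl
∑-block (suc q) k f = trans (∑-split k (q * k) f) (cong (∑ k f +_) (begin
  ∑[ v < q * k ] f (k + v)                         ≡⟨ ∑-block q k (λ v → f (k + v)) ⟩
  ∑[ m < q ] ∑[ t < k ] f (k + (m * k + t))        ≡⟨ ∑-cong q (λ m _ → ∑-cong k (λ t _ → cong f (sym (+-assoc k (m * k) t)))) ⟩
  ∑[ m < q ] ∑[ t < k ] f (suc m * k + t)          ∎))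

∑-truncate : ∀ {k m} → k ≤ m → (f : ℕ → ℕ) → ∑[ v < m ] bit (does (v <? k)) * f v ≡ ∑ k f
∑-truncate {k} {m} k≤m f = begin
  ∑ m g                                   ≡⟨ cong (λ l → ∑ l g) (m+[n∸m]≡n k≤m) ⟨
  ∑ (k + (m ∸ k)) g                       ≡⟨ ∑-split k (m ∸ k) g ⟩
  ∑ k g + (∑[ v < m ∸ k ] g (k + v))      ≡⟨ cong₂ _+_ (∑-cong k inside) (∑-zero (m ∸ k) outside) ⟩
  ∑ k f + 0                               ≡⟨ +-identityʳ _ ⟩
  ∑ k f                                   ∎
  where
  g : ℕ → ℕ
  g v = bit (does (v <? k)) * f v
  inside : ∀ v → v < k → g v ≡ f v
  inside v v<k rewrite dec-true (v <? k) v<k = +-identityʳ (f v)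
  outside : ∀ v → v < m ∸ k → g (k + v) ≡ 0
  outside v _ rewrite dec-false (k + v <? k) (m+n≮m k v) = refl

∑-indicator : ∀ {m c} → c < m → ∑[ v < m ] bit (does (v ≟ c)) ≡ 1
∑-indicator {suc m} {zero}  _         = cong suc (∑-zero m (λ _ _ → refl))
∑-indicator {suc m} {suc c} (s≤s c<m) = ∑-indicator c<m

Periodic : ℕ → (ℕ → ℕ) → Set
Periodic p f = ∀ v → f (v + p) ≡ f v

∑-rotate : ∀ {p f} → Periodic p f → ∑[ v < p ] f (suc v) ≡ ∑ p f
∑-rotate {p} {f} per = +-cancelˡ-≡ (f 0) _ _ (begin
  ∑ (suc p) f               ≡⟨ cong (λ l → ∑ l f) (+-comm 1 p) ⟩
  ∑ (p + 1) f               ≡⟨ ∑-split p 1 f ⟩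
  ∑ p f + (f (p + 0) + 0)   ≡⟨ cong (∑ p f +_) (trans (+-identityʳ _) (trans (cong f (+-identityʳ p)) (per 0))) ⟩
  ∑ p f + f 0               ≡⟨ +-comm (∑ p f) (f 0) ⟩
  f 0 + ∑ p f               ∎)

∑-shift : ∀ {p f} → Periodic p f → ∀ s → ∑[ v < p ] f (s + v) ≡ ∑ p f
∑-shift per zero = refl
∑-shift {p} {f} per (suc s) = begin
  ∑[ v < p ] f (suc s + v)   ≡⟨ ∑-cong p (λ v _ → cong f (sym (+-suc s v))) ⟩
  ∑[ v < p ] f (s + suc v)   ≡⟨ ∑-rotate (λ v → trans (cong f (sym (+-assoc s v p))) (per (s + v))) ⟩
  ∑[ v < p ] f (s + v)       ≡⟨ ∑-shift per s ⟩
  ∑ p f                      ∎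

∑-periodic-* : ∀ {p f} → Periodic p f → ∀ L → ∑ (L * p) f ≡ L * ∑ p f
∑-periodic-* per zero = refl
∑-periodic-* {p} {f} per (suc L) = trans (∑-split p (L * p) f)
  (cong (∑ p f +_) (trans (∑-cong (L * p) (λ v _ → trans (cong f (+-comm p v)) (per v))) (∑-periodic-* per L)))

-- Parity and arithmetic modulo n

even⊎odd : ∀ m → Even m ⊎ Odd m
even⊎odd m = classify (m % 2) (m%n<n m 2)
  where
  classify : ∀ r → r < 2 → r ≡ 0 ⊎ r ≡ 1
  classify 0 _ = inj₁ refl
  classify 1 _ = inj₂ refl
  classify (suc (suc _)) (s≤s (s≤s ()))

even⇒*-even : ∀ m n → Even m → Even (m * n)
even⇒*-even m n m-even = begin
  (m * n) % 2                ≡⟨ %-distribˡ-* m n 2 ⟩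
  (m % 2 * (n % 2)) % 2      ≡⟨ cong (λ r → (r * (n % 2)) % 2) m-even ⟩
  0                          ∎

odd*odd : ∀ m n → Odd m → Odd n → Odd (m * n)
odd*odd m n m-odd n-odd = trans (%-distribˡ-* m n 2) (cong₂ (λ a b → (a * b) % 2) m-odd n-odd)

odd*⇒odd : ∀ m n → Odd (m * n) → Odd m × Odd n
odd*⇒odd m n mn-odd with even⊎odd m | even⊎odd n
... | inj₁ m-even | _          = ⊥-elim (0≢1+n (trans (sym (even⇒*-even m n m-even)) mn-odd))
... | inj₂ _      | inj₁ n-even = ⊥-elim (0≢1+n (trans (sym (even⇒*-even n m n-even)) (trans (cong (_% 2) (*-comm n m)) mn-odd)))
... | inj₂ m-odd  | inj₂ n-odd  = m-odd , n-odd

even*odd⇒even : ∀ m n → Even (m * n) → Odd n → Even m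
even*odd⇒even m n mn-even n-odd with even⊎odd m
... | inj₁ m-even = m-even
... | inj₂ m-odd  = ⊥-elim (0≢1+n (trans (sym mn-even) (odd*odd m n m-odd n-odd)))

even-suc⇒odd : ∀ m → Even (suc m) → Odd m
even-suc⇒odd m sm-even with even⊎odd m
... | inj₂ m-odd  = m-odd
... | inj₁ m-even = ⊥-elim (0≢1+n (begin
  0                   ≡⟨ sm-even ⟨
  (1 + m) % 2         ≡⟨ %-distribˡ-+ 1 m 2 ⟩
  (1 + m % 2) % 2     ≡⟨ cong (λ r → (1 + r) % 2) m-even ⟩
  1                   ∎))

oddᵇ : ℕ → Bool
oddᵇ m = does (m % 2 ≟ 1)

bit-oddᵇ : ∀ m → bit (oddᵇ m) % 2 ≡ m % 2
bit-oddᵇ m with even⊎odd m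
... | inj₁ m-even rewrite m-even = refl
... | inj₂ m-odd  rewrite m-odd  = refl

∑-cong-% : ∀ m d .{{_ : NonZero d}} {f g : ℕ → ℕ} → (∀ v → v < m → f v % d ≡ g v % d) → ∑ m f % d ≡ ∑ m g % d
∑-cong-% zero    d f≡g = refl
∑-cong-% (suc m) d {f} {g} f≡g = begin
  ∑ (suc m) f % d                           ≡⟨ %-distribˡ-+ (f 0) _ d ⟩
  (f 0 % d + ∑ m (f ∘ suc) % d) % d         ≡⟨ cong₂ (λ a b → (a + b) % d) (f≡g 0 z<s) (∑-cong-% m d (λ v v<m → f≡g (suc v) (s≤s v<m))) ⟩
  (g 0 % d + ∑ m (g ∘ suc) % d) % d         ≡⟨ %-distribˡ-+ (g 0) _ d ⟨
  ∑ (suc m) g % d                           ∎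

∑-odd : ∀ m {f : ℕ → ℕ} → (∀ v → v < m → Odd (f v)) → ∑ m f % 2 ≡ m % 2
∑-odd m odd = trans (∑-cong-% m 2 odd) (cong (_% 2) (trans (∑-const m 1) (*-identityʳ m)))

odd-multiplier : ∀ q k L n → Even k → q * k ≡ 1 + L * n → Odd L
odd-multiplier q k L n k-even qk≡1+Ln =
  proj₁ (odd*⇒odd L n (even-suc⇒odd (L * n) (subst Even qk≡1+Ln (trans (cong (_% 2) (*-comm q k)) (even⇒*-even k q k-even)))))

[m%d+n]%d≡[m+n]%d : ∀ m n d .{{_ : NonZero d}} → (m % d + n) % d ≡ (m + n) % d
[m%d+n]%d≡[m+n]%d m n d = begin
  (m % d + n) % d              ≡⟨ %-distribˡ-+ (m % d) n d ⟩
  (m % d % d + n % d) % d      ≡⟨ cong (λ r → (r + n % d) % d) (m%n%n≡m%n m d) ⟩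
  (m % d + n % d) % d          ≡⟨ %-distribˡ-+ m n d ⟨
  (m + n) % d                  ∎

%-cancelʳ-+ : ∀ m n o d-1 → (m + o) % suc d-1 ≡ (n + o) % suc d-1 → m % suc d-1 ≡ n % suc d-1
%-cancelʳ-+ m n o d-1 eq = begin
  m % d                              ≡⟨ reshuffle m ⟩
  ((m + o) % d + o * d-1) % d        ≡⟨ cong (λ r → (r + o * d-1) % d) eq ⟩
  ((n + o) % d + o * d-1) % d        ≡⟨ reshuffle n ⟨
  n % d                              ∎
  where
  d = suc d-1
  reshuffle : ∀ x → x % d ≡ ((x + o) % d + o * d-1) % d
  reshuffle x = begin
    x % d                          ≡⟨ [m+kn]%n≡m%n x o d ⟨
    (x + o * d) % d                ≡⟨ cong (_% d) (assoc x o d-1) ⟩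
    (x + o + o * d-1) % d          ≡⟨ [m%d+n]%d≡[m+n]%d (x + o) (o * d-1) d ⟨
    ((x + o) % d + o * d-1) % d    ∎
    where
    assoc : ∀ x o d-1 → x + o * suc d-1 ≡ x + o + o * d-1
    assoc = solve-∀

%≡⇒mod≡ : ∀ m n d .{{_ : NonZero d}} → m % d ≡ n % d → m mod d ≡ n mod d
%≡⇒mod≡ m n d eq = toℕ-injective (trans (toℕ-fromℕ< _) (trans eq (sym (toℕ-fromℕ< _))))

toℕ-mod : ∀ {d} .{{_ : NonZero d}} (j : Fin d) → toℕ j mod d ≡ j
toℕ-mod {d} j = toℕ-injective (trans (toℕ-fromℕ< _) (m<n⇒m%n≡m (toℕ<n j)))

coprime⇒inverse : ∀ {k n} → 1 < n → gcd k n ≡ 1 → ∃₂ λ q L → q * k ≡ 1 + L * n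
coprime⇒inverse {k} {n@(suc (suc n-2))} (s≤s (s≤s z≤n)) gcd≡1 with Bézout.identity (subst (GCD k n) gcd≡1 (gcd-GCD k n))
... | Bézout.+- q L 1+Ln≡qk   = q , L , sym 1+Ln≡qk
... | Bézout.-+ x zero    ()
-- Here x k ≡ -1 (mod n), so (n - 1) x inverts k.
... | Bézout.-+ x (suc y) 1+xk≡yn = x * suc n-2 , n-2 + y * suc n-2 , (begin
  x * suc n-2 * k                        ≡⟨ *-assoc x (suc n-2) k ⟩
  x * (suc n-2 * k)                      ≡⟨ cong (x *_) (*-comm (suc n-2) k) ⟩
  x * (k * suc n-2)                      ≡⟨ *-assoc x k (suc n-2) ⟨
  x * k * suc n-2                        ≡⟨ cong (_* suc n-2) (suc-injective 1+xk≡yn) ⟩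
  (suc n-2 + y * n) * suc n-2            ≡⟨ regroup n-2 y ⟩
  1 + (n-2 + y * suc n-2) * n            ∎)
  where
  regroup : ∀ n-2 y → (suc n-2 + y * suc (suc n-2)) * suc n-2 ≡ 1 + (n-2 + y * suc n-2) * suc (suc n-2)
  regroup = solve-∀

-- Periodic windows

∑-windows : ∀ ν d κ {f} → Periodic (ν * d) f → ∀ r →
  ∑[ m < ν ] ∑[ t < κ * d ] f (r + m * d + t) ≡ κ * ∑ (ν * d) f
∑-windows ν d κ {f} per r = begin
  ∑[ m < ν ] ∑[ t < κ * d ] f (r + m * d + t)
    ≡⟨ ∑-cong ν (λ m _ → ∑-block κ d _) ⟩
  ∑[ m < ν ] ∑[ s < κ ] ∑[ u < d ] f (r + m * d + (s * d + u))
    ≡⟨ ∑-swap ν κ _ ⟩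
  ∑[ s < κ ] ∑[ m < ν ] ∑[ u < d ] f (r + m * d + (s * d + u))
    ≡⟨ ∑-cong κ (λ s _ → ∑-cong ν (λ m _ → ∑-cong d (λ u _ → cong f (regroup r m s d u)))) ⟩
  ∑[ s < κ ] ∑[ m < ν ] ∑[ u < d ] f (r + s * d + (m * d + u))
    ≡⟨ ∑-cong κ (λ s _ → ∑-block ν d _) ⟨
  ∑[ s < κ ] ∑[ v < ν * d ] f (r + s * d + v)
    ≡⟨ ∑-cong κ (λ s _ → ∑-shift per (r + s * d)) ⟩
  ∑[ _ < κ ] ∑ (ν * d) f
    ≡⟨ ∑-const κ _ ⟩
  κ * ∑ (ν * d) f
    ∎
  where
  regroup : ∀ r m s d u → r + m * d + (s * d + u) ≡ r + s * d + (m * d + u)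
  regroup = solve-∀

odd-windows-impossible : ∀ {f n k} ν d κ → Periodic n f → n ≡ ν * d → k ≡ κ * d → Even κ → Odd ν → ∀ r →
  ¬ (∀ m → m < ν → Odd (∑[ t < k ] f (r + m * d + t)))
odd-windows-impossible {f} ν d κ per refl refl κ-even ν-odd r odd = 0≢1+n (begin
  0                                                  ≡⟨ even⇒*-even κ _ κ-even ⟨
  κ * ∑ (ν * d) f % 2                                ≡⟨ cong (_% 2) (∑-windows ν d κ per r) ⟨
  (∑[ m < ν ] ∑[ t < κ * d ] f (r + m * d + t)) % 2  ≡⟨ ∑-odd ν odd ⟩
  ν % 2                                              ≡⟨ ν-odd ⟩
  1                                                  ∎)

-- The cyclic hypergraph

∣∣≡∑ : ∀ {m} (p : Subset m) (g : ℕ → ℕ) → (∀ j → bit (lookup p j) ≡ g (toℕ j)) → ∣ p ∣ ≡ ∑ m g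
∣∣≡∑ []          g p≡g = refl
∣∣≡∑ (true  ∷ p) g p≡g = cong₂ _+_ (p≡g Fin.zero) (∣∣≡∑ p (g ∘ suc) (p≡g ∘ Fin.suc))
∣∣≡∑ (false ∷ p) g p≡g = cong₂ _+_ (p≡g Fin.zero) (∣∣≡∑ p (g ∘ suc) (p≡g ∘ Fin.suc))

module Cyclic (n-1 k : ℕ) where

  n : ℕ
  n = suc n-1

  G : Hypergraph n
  G = cyclicHypergraph n k

  Critical : Set
  Critical = ∀ e → e ∈ edges G → OddBipartite (deleteEdge G e)

  window∈G : (i : Fin n) → window k i ∈ edges G
  window∈G i = ∈-map⁺ (window k) (∈-allFin i)

  window∈deleteEdge : ∀ {e} (i : Fin n) → window k i ≢ e → window k i ∈ edges (deleteEdge G e)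
  window∈deleteEdge {e} i ≢e = ∈-filter⁺ (λ f → ¬? (≡-dec Bool._≟_ f e)) (window∈G i) ≢e

  χ : Subset n → ℕ → ℕ
  χ U j = bit (lookup U (j mod n))

  χ-periodic : (U : Subset n) → Periodic n (χ U)
  χ-periodic U v = cong (λ j → bit (lookup U j)) (%≡⇒mod≡ (v + n) v n ([m+n]%n≡m%n v n))

  ∣∣≡∑χ : (U : Subset n) → ∣ U ∣ ≡ ∑ n (χ U)
  ∣∣≡∑χ U = ∣∣≡∑ U (χ U) (λ j → cong (λ i → bit (lookup U i)) (sym (toℕ-mod j)))

  offset : Fin n → Fin n → ℕ
  offset i j = ((toℕ j + n) ∸ toℕ i) % n

  lookup-window : (i j : Fin n) → lookup (window k i) j ≡ does (offset i j <? k)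
  lookup-window i j = lookup∘tabulate (inWindow k i) j

  offset-self : (i : Fin n) → offset i i ≡ 0
  offset-self i = trans (cong (_% n) (m+n∸m≡n (toℕ i) n)) (n%n≡0 n)

  offset-zero : (j : Fin n) → offset Fin.zero j ≡ toℕ j
  offset-zero j = trans ([m+n]%n≡m%n (toℕ j) n) (m<n⇒m%n≡m (toℕ<n j))

  offset-suc-inject₁ : (j : Fin n-1) → offset (Fin.suc j) (inject₁ j) ≡ n-1
  offset-suc-inject₁ j = begin
    ((toℕ (inject₁ j) + n) ∸ suc (toℕ j)) % n  ≡⟨ cong (λ t → ((t + n) ∸ suc (toℕ j)) % n) (toℕ-inject₁ j) ⟩
    ((toℕ j + n) ∸ suc (toℕ j)) % n            ≡⟨ cong (λ t → (t ∸ suc (toℕ j)) % n) (+-suc (toℕ j) n-1) ⟩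
    ((toℕ j + n-1) ∸ toℕ j) % n                ≡⟨ cong (_% n) (m+n∸m≡n (toℕ j) n-1) ⟩
    n-1 % n                                    ≡⟨ m<n⇒m%n≡m (n<1+n n-1) ⟩
    n-1                                        ∎

  offset-shift : (i : Fin n) → ∀ {v} → v < n → offset i ((toℕ i + v) mod n) ≡ v
  offset-shift i {v} v<n = trans (%-cancelʳ-+ ((a + n) ∸ toℕ i) v (toℕ i) n-1 shifted) (m<n⇒m%n≡m v<n)
    where
    a : ℕ
    a = toℕ ((toℕ i + v) mod n)
    shifted : ((a + n) ∸ toℕ i + toℕ i) % n ≡ (v + toℕ i) % n
    shifted = begin
      ((a + n) ∸ toℕ i + toℕ i) % n  ≡⟨ cong (_% n) (m∸n+n≡m (≤-trans (<⇒≤ (toℕ<n i)) (m≤n+m n a))) ⟩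
      (a + n) % n                    ≡⟨ [m+n]%n≡m%n a n ⟩
      a % n                          ≡⟨ cong (_% n) (toℕ-fromℕ< (m%n<n (toℕ i + v) n)) ⟩
      (toℕ i + v) % n % n            ≡⟨ m%n%n≡m%n (toℕ i + v) n ⟩
      (toℕ i + v) % n                ≡⟨ cong (_% n) (+-comm (toℕ i) v) ⟩
      (v + toℕ i) % n                ∎

  window≡⇒offset< : ∀ i i' → window k i ≡ window k i' → ∀ j → offset i j < k → offset i' j < k
  window≡⇒offset< i i' Wi≡Wi' j i<k = does<?⇒< (begin
    does (offset i' j <? k)  ≡⟨ lookup-window i' j ⟨
    lookup (window k i') j   ≡⟨ cong (λ W → lookup W j) Wi≡Wi' ⟨
    lookup (window k i) j    ≡⟨ lookup-window i j ⟩
    does (offset i j <? k)   ≡⟨ dec-true (offset i j <? k) i<k ⟩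
    true                     ∎)

  window≡window₀⇒≡zero : 0 < k → k < n → (i : Fin n) → window k i ≡ window k Fin.zero → i ≡ Fin.zero
  window≡window₀⇒≡zero _   _   Fin.zero    _     = refl
  window≡window₀⇒≡zero 0<k k<n (Fin.suc j) Wi≡W₀ with suc (toℕ j) <? k
  -- If 1 + j ≥ k, vertex 1 + j lies in its own window but not in W₀;
  -- otherwise vertex j lies in W₀ but, at offset n - 1 ≥ k, not in W_{1+j}.
  ... | no  i≮k = ⊥-elim (i≮k (subst (_< k) (offset-zero (Fin.suc j))
          (window≡⇒offset< (Fin.suc j) Fin.zero Wi≡W₀ (Fin.suc j) (subst (_< k) (sym (offset-self (Fin.suc j))) 0<k))))
  ... | yes i<k = ⊥-elim (<⇒≱ (subst (_< k) (offset-suc-inject₁ j)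
          (window≡⇒offset< Fin.zero (Fin.suc j) (sym Wi≡W₀) (inject₁ j) (subst (_< k) (sym (trans (offset-zero (inject₁ j)) (toℕ-inject₁ j))) (<-trans (n<1+n _) i<k))))
          (s≤s⁻¹ k<n))

  ∣window∩∣≡∑χ : k ≤ n → (i : Fin n) (U : Subset n) → ∣ window k i ∩ U ∣ ≡ ∑[ t < k ] χ U (toℕ i + t)
  ∣window∩∣≡∑χ k≤n i U = begin
    ∣ window k i ∩ U ∣                                ≡⟨ ∣∣≡∑χ (window k i ∩ U) ⟩
    ∑ n (χ (window k i ∩ U))                          ≡⟨ ∑-shift (χ-periodic (window k i ∩ U)) (toℕ i) ⟨
    ∑[ v < n ] χ (window k i ∩ U) (toℕ i + v)         ≡⟨ ∑-cong n (λ v v<n → χ-window∩ v<n) ⟩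
    ∑[ v < n ] bit (does (v <? k)) * χ U (toℕ i + v)  ≡⟨ ∑-truncate k≤n _ ⟩
    ∑[ t < k ] χ U (toℕ i + t)                        ∎
    where
    χ-window∩ : ∀ {v} → v < n → χ (window k i ∩ U) (toℕ i + v) ≡ bit (does (v <? k)) * χ U (toℕ i + v)
    χ-window∩ {v} v<n = begin
      bit (lookup (window k i ∩ U) x)                  ≡⟨ cong bit (lookup-zipWith _∧_ x (window k i) U) ⟩
      bit (lookup (window k i) x ∧ lookup U x)         ≡⟨ bit-∧ (lookup (window k i) x) (lookup U x) ⟩
      bit (lookup (window k i) x) * bit (lookup U x)   ≡⟨ cong (λ b → bit b * bit (lookup U x)) (lookup-window i x) ⟩
      bit (does (offset i x <? k)) * bit (lookup U x)  ≡⟨ cong (λ o → bit (does (o <? k)) * bit (lookup U x)) (offset-shift i v<n) ⟩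
      bit (does (v <? k)) * bit (lookup U x)           ∎
      where
      x : Fin n
      x = (toℕ i + v) mod n

  window-odd⇒∑χ-odd : k ≤ n → (U : Subset n) (i : Fin n) {s : ℕ} → toℕ i ≡ s →
          Odd ∣ window k i ∩ U ∣ → Odd (∑[ t < k ] χ U (s + t))
  window-odd⇒∑χ-odd k≤n U i refl odd = subst Odd (∣window∩∣≡∑χ k≤n i U) odd

  ¬oddBipartite : k ≤ n → Even k → Odd n → ¬ OddBipartite G
  ¬oddBipartite k≤n k-even n-odd (U , U-odd) =
    odd-windows-impossible n 1 k (χ-periodic U) (sym (*-identityʳ n)) (sym (*-identityʳ k)) k-even n-odd 0
      λ m m<n → window-odd⇒∑χ-odd k≤n U (fromℕ< m<n) (trans (toℕ-fromℕ< m<n) (sym (*-identityʳ m)))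
                  (All.lookup U-odd (window∈G (fromℕ< m<n)))

  common-divisor⇒¬critical : ∀ {d κ ν} → 0 < k → k < n → Even k → Odd n → 2 ≤ d → k ≡ κ * d → n ≡ ν * d →
    ¬ Critical
  common-divisor⇒¬critical {d} {κ} {ν} 0<k k<n k-even n-odd 2≤d k≡κd n≡νd critical =
    odd-windows-impossible ν d κ (χ-periodic U) n≡νd k≡κd κ-even ν-odd 1 odd-window
    where
    ν-odd×d-odd : Odd ν × Odd d
    ν-odd×d-odd = odd*⇒odd ν d (subst Odd n≡νd n-odd)
    ν-odd = proj₁ ν-odd×d-odd
    κ-even : Even κ
    κ-even = even*odd⇒even κ d (subst Even k≡κd k-even) (proj₂ ν-odd×d-odd)
    W₀ : Subset n
    W₀ = window k Fin.zero
    U-odd : OddBipartite (deleteEdge G W₀)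
    U-odd = critical W₀ (window∈G Fin.zero)
    U = proj₁ U-odd
    odd-window : ∀ m → m < ν → Odd (∑[ t < k ] χ U (1 + m * d + t))
    odd-window m m<ν = window-odd⇒∑χ-odd (<⇒≤ k<n) U i (toℕ-fromℕ< start<n) (All.lookup (proj₂ U-odd) (window∈deleteEdge i Wi≢W₀))
      where
      start<n : 1 + m * d < n
      start<n = ≤-trans (+-monoˡ-≤ (m * d) 2≤d) (subst (suc m * d ≤_) (sym n≡νd) (*-monoˡ-≤ d m<ν))
      i : Fin n
      i = fromℕ< start<n
      Wi≢W₀ : window k i ≢ W₀
      Wi≢W₀ Wi≡W₀ = 1+n≢0 (trans (sym (toℕ-fromℕ< start<n)) (cong toℕ (window≡window₀⇒≡zero 0<k k<n i Wi≡W₀)))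

  critical⇒coprime : 0 < k → k < n → Even k → Odd n → Critical → gcd k n ≡ 1
  critical⇒coprime 0<k k<n k-even n-odd critical with gcd k n | gcd[m,n]∣m k n | gcd[m,n]∣n k n
  ... | 0              | _              | divides ν n≡ν*0 = ⊥-elim (1+n≢0 (trans n≡ν*0 (*-zeroʳ ν)))
  ... | 1              | _              | _               = refl
  ... | d@(suc (suc _)) | divides κ k≡κd | divides ν n≡νd  =
    ⊥-elim (common-divisor⇒¬critical {d} {κ} {ν} 0<k k<n k-even n-odd (s≤s (s≤s z≤n)) k≡κd n≡νd critical)

  visits : ℕ → ℕ → ℕ → ℕ
  visits q c j = ∑[ m < q ] bit (does ((j + m * k) % n ≟ c))

  visits-% : ∀ q c j → visits q c (j % n) ≡ visits q c j
  visits-% q c j = ∑-cong q (λ m _ → cong (λ x → bit (does (x ≟ c))) ([m%d+n]%d≡[m+n]%d j (m * k) n))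

  ∑-visits : ∀ q L c i → q * k ≡ 1 + L * n → c < n → i < n →
             ∑[ t < k ] visits q c (i + t) ≡ bit (does (i ≟ c)) + L
  ∑-visits q L c i qk≡1+Ln c<n i<n = begin
    ∑[ t < k ] visits q c (i + t)     ≡⟨ ∑-cong k (λ t _ → ∑-cong q (λ m _ → cong (λ x → bit (does (x % n ≟ c))) (reorder i t m k))) ⟩
    ∑[ t < k ] ∑[ m < q ] F (m * k + t) ≡⟨ ∑-swap k q _ ⟩
    ∑[ m < q ] ∑[ t < k ] F (m * k + t) ≡⟨ ∑-block q k F ⟨
    ∑ (q * k) F                         ≡⟨ cong (λ l → ∑ l F) qk≡1+Ln ⟩
    F 0 + ∑ (L * n) (F ∘ suc)           ≡⟨ cong (F 0 +_) (∑-periodic-* (F-periodic ∘ suc) L) ⟩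
    F 0 + L * ∑ n (F ∘ suc)             ≡⟨ cong (λ s → F 0 + L * s) (∑-rotate F-periodic) ⟩
    F 0 + L * ∑ n F                     ≡⟨ cong₂ (λ a s → a + L * s) F0 ∑F ⟩
    bit (does (i ≟ c)) + L * 1          ≡⟨ cong (bit (does (i ≟ c)) +_) (*-identityʳ L) ⟩
    bit (does (i ≟ c)) + L              ∎
    where
    reorder : ∀ i t m k → i + t + m * k ≡ i + (m * k + t)
    reorder = solve-∀
    hit : ℕ → ℕ
    hit w = bit (does (w % n ≟ c))
    hit-periodic : Periodic n hit
    hit-periodic w = cong (λ x → bit (does (x ≟ c))) ([m+n]%n≡m%n w n)
    F : ℕ → ℕ
    F v = hit (i + v)
    F-periodic : Periodic n F
    F-periodic v = trans (cong hit (sym (+-assoc i v n))) (hit-periodic (i + v))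
    F0 : F 0 ≡ bit (does (i ≟ c))
    F0 = cong (λ x → bit (does (x ≟ c))) (trans (cong (_% n) (+-identityʳ i)) (m<n⇒m%n≡m i<n))
    ∑F : ∑ n F ≡ 1
    ∑F = begin
      ∑ n F                          ≡⟨ ∑-shift hit-periodic i ⟩
      ∑ n hit                        ≡⟨ ∑-cong n (λ v v<n → cong (λ x → bit (does (x ≟ c))) (m<n⇒m%n≡m v<n)) ⟩
      ∑[ v < n ] bit (does (v ≟ c))  ≡⟨ ∑-indicator c<n ⟩
      1                              ∎

  oddVisitors : ℕ → ℕ → Subset n
  oddVisitors q c = tabulate (λ j → oddᵇ (visits q c (toℕ j)))

  χ-oddVisitors : ∀ q c j → χ (oddVisitors q c) j % 2 ≡ visits q c j % 2
  χ-oddVisitors q c j = begin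
    bit (lookup (oddVisitors q c) (j mod n)) % 2   ≡⟨ cong (λ b → bit b % 2) (lookup∘tabulate (λ x → oddᵇ (visits q c (toℕ x))) (j mod n)) ⟩
    bit (oddᵇ (visits q c (toℕ (j mod n)))) % 2    ≡⟨ bit-oddᵇ (visits q c (toℕ (j mod n))) ⟩
    visits q c (toℕ (j mod n)) % 2                 ≡⟨ cong (λ x → visits q c x % 2) (toℕ-fromℕ< (m%n<n j n)) ⟩
    visits q c (j % n) % 2                         ≡⟨ cong (_% 2) (visits-% q c j) ⟩
    visits q c j % 2                               ∎

  oddVisitors-odd : ∀ q L {c} → k ≤ n → q * k ≡ 1 + L * n → Odd L → c < n →
                    (i : Fin n) → toℕ i ≢ c → Odd ∣ window k i ∩ oddVisitors q c ∣
  oddVisitors-odd q L {c} k≤n qk≡1+Ln L-odd c<n i i≢c = begin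
    ∣ window k i ∩ oddVisitors q c ∣ % 2                ≡⟨ cong (_% 2) (∣window∩∣≡∑χ k≤n i (oddVisitors q c)) ⟩
    (∑[ t < k ] χ (oddVisitors q c) (toℕ i + t)) % 2   ≡⟨ ∑-cong-% k 2 (λ t _ → χ-oddVisitors q c (toℕ i + t)) ⟩
    (∑[ t < k ] visits q c (toℕ i + t)) % 2             ≡⟨ cong (_% 2) (∑-visits q L c (toℕ i) qk≡1+Ln c<n (toℕ<n i)) ⟩
    (bit (does (toℕ i ≟ c)) + L) % 2                   ≡⟨ cong (λ b → (bit b + L) % 2) (dec-false (toℕ i ≟ c) i≢c) ⟩
    L % 2                                              ≡⟨ L-odd ⟩
    1                                                  ∎

  inverse⇒critical : ∀ q L → k ≤ n → q * k ≡ 1 + L * n → Odd L → Critical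
  inverse⇒critical q L k≤n qk≡1+Ln L-odd e e∈G with ∈-map⁻ (window k) {xs = allFin n} e∈G
  ... | c , _ , e≡Wc = oddVisitors q (toℕ c) , All.tabulate odd
    where
    odd : ∀ {f} → f ∈ edges (deleteEdge G e) → Odd ∣ f ∩ oddVisitors q (toℕ c) ∣
    odd f∈G-e with ∈-filter⁻ (λ f → ¬? (≡-dec Bool._≟_ f e)) {xs = edges G} f∈G-e
    ... | f∈G , f≢e with ∈-map⁻ (window k) {xs = allFin n} f∈G
    ... | i , _ , refl = oddVisitors-odd q L k≤n qk≡1+Ln L-odd (toℕ<n c) i
                           (λ i≡c → f≢e (trans (cong (window k) (toℕ-injective i≡c)) (sym e≡Wc)))

theorem4p8 : (k n : ℕ) → Even k → 2 < k → Odd n → k < n →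
    (MinimalNonOddBipartite (cyclicHypergraph n k) ⇔ gcd k n ≡ 1)
theorem4p8 k zero      _      _   _     ()
theorem4p8 k (suc n-1) k-even 2<k n-odd k<n = mk⇔
  (λ (_ , critical) → critical⇒coprime 0<k k<n k-even n-odd critical)
  (λ gcd≡1 → let q , L , qk≡1+Ln = coprime⇒inverse 1<n gcd≡1 in
    ¬oddBipartite (<⇒≤ k<n) k-even n-odd ,
    inverse⇒critical q L (<⇒≤ k<n) qk≡1+Ln (odd-multiplier q k L n k-even qk≡1+Ln))
  where
  open Cyclic n-1 k
  0<k : 0 < k
  0<k = <-trans z<s 2<k
  1<n : 1 < n
  1<n = <-trans (<-trans (s<s z<s) 2<k) k<n
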